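{- Let $(G,T;A,B)$ be a quasicomb and $F$ a minimum join. Let $x,y\in B$ and let $P$ be a path between $x$ and $y$ with $w_F(P)=0$. Then there is a unique vertex $z\in V(P)\cap B$ with $\delta_P(z)\cap F=\emptyset$, and the subpaths $xPz$ and $yPz$ are $F$-balanced paths of $F$-weight $0$. If $P$ is $F$-balanced, then $z=x$ or $z=y$. If $P$ is not $F$-balanced, then in each of $xPz$ and $yPz$ the edge incident to the end $x$ (resp. $y$) is in $F$, whereas the edge incident to $z$ is not in $F$.
   Context: Graphs are finite, possibly with multiple edges. A join of $(G,T)$ is $F\subseteq E(G)$ with $|\delta_G(v)\cap F|$ odd iff $v\in T$; $\nu(G,T)$ is the minimum join size. $(G,T;A,B)$ is a bipartite graft with ordered color classes $A,B$; quasicomb: $\nu(G,T)=|B\cap T|$. $w_F(e)=-1$ for $e\in F$, $1$ otherwise; $w_F(P)$ is the sum over edges of $P$. For a path $P$ and $u,v\in V(P)$, $uPv$ is the subpath between $u$ and $v$. A path $P$ with ends $s,t$ is $F$-balanced if $|\delta_P(v)\cap F|=1$ for every $v\in(V(P)\cap B)\setminus\{s,t\}$. -}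

module Defs where

open import Data.Bool using (Bool; true; false; if_then_else_; _∧_; _∨_)
open import Data.Nat using (ℕ; zero; suc; _+_; _∸_; _≤_; _<_; _%_)
open import Data.Fin using (Fin)
import Data.Fin as Fin
open import Data.Integer as ℤ using (ℤ)
open import Data.Product using (_×_; Σ; ∃; _,_)
open import Data.Sum using (_⊎_)
open import Relation.Binary.PropositionalEquality using (_≡_; _≢_)
open import Relation.Nullary.Decidable using (⌊_⌋)
open import Function using (_∘_)

countFin : ∀ {k} → (Fin k → Bool) → ℕ
countFin {zero}  f = 0
countFin {suc k} f = (if f Fin.zero then 1 else 0) + countFin (f ∘ Fin.suc)

countBelow : ℕ → (ℕ → Bool) → ℕ
countBelow zero    f = 0
countBelow (suc k) f = countBelow k f + (if f k then 1 else 0)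

sumBelow : ℕ → (ℕ → ℤ) → ℤ
sumBelow zero    g = ℤ.0ℤ
sumBelow (suc k) g = sumBelow k g ℤ.+ g k

-- A bipartite graft (G,T;A,B): a finite multigraph with vertex set Fin n,
-- edge set Fin m, edge e having ends end₁ e and end₂ e; T ⊆ V given by its
-- indicator; the ordered colour classes are B = {v | inB v ≡ true} and
-- A = {v | inB v ≡ false}; every edge joins A and B.
record BipartiteGraft : Set where
  field
    n m   : ℕ
    end₁  : Fin m → Fin n
    end₂  : Fin m → Fin n
    T     : Fin n → Bool
    inB   : Fin n → Bool
    bipartite : ∀ e → inB (end₁ e) ≢ inB (end₂ e)

module _ (G : BipartiteGraft) where
  open BipartiteGraft G

  EdgeSet : Set
  EdgeSet = Fin m → Bool

  incident : Fin m → Fin n → Bool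
  incident e v = ⌊ end₁ e Fin.≟ v ⌋ ∨ ⌊ end₂ e Fin.≟ v ⌋

  degIn : EdgeSet → Fin n → ℕ
  degIn F v = countFin (λ e → F e ∧ incident e v)

  Odd : ℕ → Set
  Odd k = k % 2 ≡ 1

  size : EdgeSet → ℕ
  size F = countFin F

  IsJoin : EdgeSet → Set
  IsJoin F = ∀ v → (Odd (degIn F v) → T v ≡ true) × (T v ≡ true → Odd (degIn F v))

  IsMinJoin : EdgeSet → Set
  IsMinJoin F = IsJoin F × (∀ F' → IsJoin F' → size F ≤ size F')

  sizeBT : ℕ
  sizeBT = countFin (λ v → inB v ∧ T v)

  -- quasicomb: ν(G,T) = |B ∩ T|, i.e. a join exists and the minimum join size is |B ∩ T|
  IsQuasicomb : Set
  IsQuasicomb = Σ EdgeSet (λ J → IsJoin J × size J ≡ sizeBT × (∀ J' → IsJoin J' → sizeBT ≤ size J'))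

  -- Raw data of a path: length, vertex sequence v_0..v_len, edge sequence e_0..e_{len-1}
  -- (edge e_i joins v_i and v_{i+1}); values at indices out of range are irrelevant.
  record PathData : Set where
    constructor mkPath
    field
      len : ℕ
      vtx : ℕ → Fin n
      edg : ℕ → Fin m
  open PathData public

  IsPath : PathData → Set
  IsPath P =
    (∀ i → i < len P →
        (end₁ (edg P i) ≡ vtx P i × end₂ (edg P i) ≡ vtx P (suc i))
      ⊎ (end₁ (edg P i) ≡ vtx P (suc i) × end₂ (edg P i) ≡ vtx P i))
    × (∀ i j → i ≤ len P → j ≤ len P → vtx P i ≡ vtx P j → i ≡ j)

  IsPathBetween : PathData → Fin n → Fin n → Set
  IsPathBetween P x y = IsPath P × vtx P 0 ≡ x × vtx P (len P) ≡ y

  OnPath : PathData → Fin n → Set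
  OnPath P v = ∃ λ p → p ≤ len P × vtx P p ≡ v

  degPathIn : EdgeSet → PathData → Fin n → ℕ
  degPathIn F P v = countBelow (len P) (λ i → F (edg P i) ∧ incident (edg P i) v)

  wt : EdgeSet → Fin m → ℤ
  wt F e = if F e then ℤ.-1ℤ else ℤ.1ℤ

  weight : EdgeSet → PathData → ℤ
  weight F P = sumBelow (len P) (λ i → wt F (edg P i))

  Balanced : EdgeSet → PathData → Set
  Balanced F P = ∀ v → OnPath P v → inB v ≡ true →
    v ≢ vtx P 0 → v ≢ vtx P (len P) → degPathIn F P v ≡ 1

  subpath : PathData → ℕ → ℕ → PathData
  subpath P i j = mkPath (j ∸ i) (λ l → vtx P (i + l)) (λ l → edg P (i + l))

{-# OPTIONS --safe #-}

-- Since F is a minimum join of a quasicomb, |F| = |B ∩ T|; counting the edges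
-- of F at their ends in B then shows that every vertex of B meets at most one
-- edge of F.  Colours alternate along P, so P has even length 2K and its
-- vertices in B are v_0, v_2, …, v_2K.  Every edge of P has exactly one end in
-- B, so the F-degrees on P of these K + 1 vertices add up to |F ∩ E(P)|, which
-- is K because w_F(P) = 0.  Hence exactly one of them, z = v_2j, has degree 0
-- and all the others have degree 1.  Then the first 2j edges of P contain j
-- edges of F, so both subpaths at z have weight 0, and the degrees of z and of
-- the ends of P determine which edges at the ends of xPz and zPy lie in F.

module Submission where

open import Defs
open import Algebra.Bundles using (AbelianGroup)
open import Data.Bool using (Bool; true; false; if_then_else_; _∧_; _∨_; not)
open import Data.Bool.Properties
  using (∧-identityʳ; ∧-zeroʳ; ∨-zeroʳ; ∨-comm; ∧-conicalˡ; ∧-conicalʳ; ¬-not; not-involutive; T-≡)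
open import Data.Empty using (⊥)
open import Data.Fin using (Fin; zero; suc; punchIn)
import Data.Fin as Fin
open import Data.Fin.Properties using (punchInᵢ≢i)
open import Data.Integer using (ℤ; 0ℤ; 1ℤ; -1ℤ)
import Data.Integer as ℤ
import Data.Integer.Properties as ℤ
open import Data.Nat
  using (ℕ; zero; suc; _+_; _*_; _∸_; _%_; _≤_; _<_; z≤n; s≤s; z<s; _≡ᵇ_; _<ᵇ_; _≤?_; _≟_)
open import Data.Nat.Properties
open import Data.Product using (Σ; ∃; _×_; _,_; proj₁; proj₂)
open import Data.Sum using (_⊎_; inj₁; inj₂; [_,_]′)
open import Function using (_∘_; Equivalence)
open import Relation.Binary.PropositionalEquality
open import Relation.Nullary using (¬_; yes; no; contradiction)
open import Relation.Nullary.Decidable using (Dec; ⌊_⌋; isYes≗does; dec-true; dec-false)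

open import Algebra.Properties.CommutativeMonoid.Sum +-0-commutativeMonoid
  using (sum; sum-cong-≗; sum-remove; sum-replicate-zero; ∑-comm; ∑-distrib-+)
open import Algebra.Properties.CommutativeSemigroup +-commutativeSemigroup
  using (interchange)
open import Algebra.Properties.CommutativeSemigroup ℤ.+-commutativeSemigroup
  using () renaming (interchange to ℤ-interchange)
open import Algebra.Properties.Group (AbelianGroup.group ℤ.+-0-abelianGroup)
  using () renaming (identityˡ-unique to ℤ-identityˡ-unique)


𝟙 : Bool → ℕ
𝟙 b = if b then 1 else 0

𝟙≤1 : ∀ x → 𝟙 x ≤ 1
𝟙≤1 true  = ≤-refl
𝟙≤1 false = z≤n

𝟙-injective : ∀ {x y} → 𝟙 x ≡ 𝟙 y → x ≡ y
𝟙-injective {true}  {true}  _ = refl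
𝟙-injective {false} {false} _ = refl

𝟙+𝟙≤1 : ∀ {x y} → (x ≡ true → y ≡ true → ⊥) → 𝟙 x + 𝟙 y ≤ 1
𝟙+𝟙≤1 {true}  {true}  not-both = contradiction refl (not-both refl)
𝟙+𝟙≤1 {true}  {false} _        = ≤-refl
𝟙+𝟙≤1 {false} {y}     _        = 𝟙≤1 y

𝟙-∧-∨ : ∀ x {y z} → y ∧ z ≡ false → 𝟙 (x ∧ (y ∨ z)) ≡ 𝟙 (x ∧ y) + 𝟙 (x ∧ z)
𝟙-∧-∨ false         _  = refl
𝟙-∧-∨ true {true}  {true}  ()
𝟙-∧-∨ true {true}  {false} _ = refl
𝟙-∧-∨ true {false} {z}     _ = refl

≤1-cases : ∀ {n} → n ≤ 1 → n ≡ 0 ⊎ n ≡ 1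
≤1-cases z≤n       = inj₁ refl
≤1-cases (s≤s z≤n) = inj₂ refl

⌊⌋-true : ∀ {A : Set} (a? : Dec A) → A → ⌊ a? ⌋ ≡ true
⌊⌋-true a? a = trans (isYes≗does a?) (dec-true a? a)

⌊⌋-false : ∀ {A : Set} (a? : Dec A) → ¬ A → ⌊ a? ⌋ ≡ false
⌊⌋-false a? ¬a = trans (isYes≗does a?) (dec-false a? ¬a)

≡ᵇ-true : ∀ {m n} → m ≡ n → (m ≡ᵇ n) ≡ true
≡ᵇ-true {m} {n} m≡n = Equivalence.to T-≡ (≡⇒≡ᵇ m n m≡n)

≡ᵇ-false : ∀ {m n} → m ≢ n → (m ≡ᵇ n) ≡ false
≡ᵇ-false {m} {n} m≢n with m ≡ᵇ n in eq
... | false = refl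
... | true  = contradiction (≡ᵇ⇒≡ m n (Equivalence.from T-≡ eq)) m≢n

<ᵇ-true : ∀ {m n} → m < n → (m <ᵇ n) ≡ true
<ᵇ-true m<n = Equivalence.to T-≡ (<⇒<ᵇ m<n)

<ᵇ-irrefl : ∀ n → (n <ᵇ n) ≡ false
<ᵇ-irrefl zero    = refl
<ᵇ-irrefl (suc n) = <ᵇ-irrefl n

suc-≡ᵇ-disjoint : ∀ i q → (suc i ≡ᵇ q) ∧ (i ≡ᵇ q) ≡ false
suc-≡ᵇ-disjoint i       zero    = refl
suc-≡ᵇ-disjoint zero    (suc q) = ∧-zeroʳ (zero ≡ᵇ q)
suc-≡ᵇ-disjoint (suc i) (suc q) = suc-≡ᵇ-disjoint i q

even-or-odd : ∀ q → ∃ λ j → q ≡ 2 * j ⊎ q ≡ suc (2 * j)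
even-or-odd zero = 0 , inj₁ refl
even-or-odd (suc q) with even-or-odd q
... | j , inj₁ q≡2j  = j , inj₂ (cong suc q≡2j)
... | j , inj₂ q≡1+2j = suc j , inj₁ (trans (cong suc q≡1+2j) (sym (*-suc 2 j)))

countBelow-cong : ∀ k {f g : ℕ → Bool} → (∀ i → i < k → f i ≡ g i) →
  countBelow k f ≡ countBelow k g
countBelow-cong zero    _   = refl
countBelow-cong (suc k) f≗g =
  cong₂ _+_ (countBelow-cong k (λ i i<k → f≗g i (m<n⇒m<1+n i<k))) (cong 𝟙 (f≗g k ≤-refl))

countBelow-false : ∀ k {f : ℕ → Bool} → (∀ i → f i ≡ false) → countBelow k f ≡ 0
countBelow-false zero    _  = refl
countBelow-false (suc k) f≗false =
  cong₂ _+_ (countBelow-false k f≗false) (cong 𝟙 (f≗false k))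

countBelow-+ : ∀ p r (f : ℕ → Bool) →
  countBelow (p + r) f ≡ countBelow p f + countBelow r (λ l → f (p + l))
countBelow-+ p zero    f = trans (cong (λ n → countBelow n f) (+-identityʳ p)) (sym (+-identityʳ _))
countBelow-+ p (suc r) f = begin
  countBelow (p + suc r) f                                       ≡⟨ cong (λ n → countBelow n f) (+-suc p r) ⟩
  countBelow (p + r) f + 𝟙 (f (p + r))                           ≡⟨ cong (_+ 𝟙 (f (p + r))) (countBelow-+ p r f) ⟩
  countBelow p f + countBelow r (λ l → f (p + l)) + 𝟙 (f (p + r)) ≡⟨ +-assoc (countBelow p f) _ _ ⟩
  countBelow p f + countBelow (suc r) (λ l → f (p + l))          ∎
  where open ≡-Reasoning

countBelow-∨ : ∀ k (f g h : ℕ → Bool) → (∀ i → g i ∧ h i ≡ false) →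
  countBelow k (λ i → f i ∧ (g i ∨ h i))
    ≡ countBelow k (λ i → f i ∧ g i) + countBelow k (λ i → f i ∧ h i)
countBelow-∨ zero    f g h _        = refl
countBelow-∨ (suc k) f g h disjoint = begin
  countBelow k (λ i → f i ∧ (g i ∨ h i)) + 𝟙 (f k ∧ (g k ∨ h k))
    ≡⟨ cong₂ _+_ (countBelow-∨ k f g h disjoint) (𝟙-∧-∨ (f k) (disjoint k)) ⟩
  (countBelow k (λ i → f i ∧ g i) + countBelow k (λ i → f i ∧ h i)) + (𝟙 (f k ∧ g k) + 𝟙 (f k ∧ h k))
    ≡⟨ interchange (countBelow k (λ i → f i ∧ g i)) _ (𝟙 (f k ∧ g k)) _ ⟩
  countBelow (suc k) (λ i → f i ∧ g i) + countBelow (suc k) (λ i → f i ∧ h i) ∎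
  where open ≡-Reasoning

countBelow-point : ∀ k q (f : ℕ → Bool) → countBelow k (λ i → f i ∧ (i ≡ᵇ q)) ≡ 𝟙 (f q ∧ (q <ᵇ k))
countBelow-point zero    q       f = cong 𝟙 (sym (∧-zeroʳ (f q)))
countBelow-point (suc k) zero    f = begin
  countBelow (suc k) (λ i → f i ∧ (i ≡ᵇ 0))
    ≡⟨ countBelow-+ 1 k _ ⟩
  𝟙 (f 0 ∧ true) + countBelow k (λ i → f (suc i) ∧ false)
    ≡⟨ cong (𝟙 (f 0 ∧ true) +_) (countBelow-false k (∧-zeroʳ ∘ f ∘ suc)) ⟩
  𝟙 (f 0 ∧ true) + 0
    ≡⟨ +-identityʳ _ ⟩
  𝟙 (f 0 ∧ true) ∎
  where open ≡-Reasoning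
countBelow-point (suc k) (suc q) f = begin
  countBelow (suc k) (λ i → f i ∧ (i ≡ᵇ suc q))
    ≡⟨ countBelow-+ 1 k _ ⟩
  𝟙 (f 0 ∧ false) + countBelow k (λ i → f (suc i) ∧ (i ≡ᵇ q))
    ≡⟨ cong₂ _+_ (cong 𝟙 (∧-zeroʳ (f 0))) (countBelow-point k q (f ∘ suc)) ⟩
  𝟙 (f (suc q) ∧ (q <ᵇ k)) ∎
  where open ≡-Reasoning

incoming : (ℕ → Bool) → ℕ → Bool
incoming c zero    = false
incoming c (suc q) = c q

-- Number of true labels among the (at most two) edges at position q of a
-- path whose i-th edge carries the label c i.
degAt : (ℕ → Bool) → ℕ → ℕ
degAt c q = 𝟙 (incoming c q) + 𝟙 (c q)

incoming-pred : ∀ {c} q → 0 < q → incoming c q ≡ c (q ∸ 1)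
incoming-pred (suc q) _ = refl

countBelow-adjacent : ∀ k q (f : ℕ → Bool) →
  countBelow k (λ i → f i ∧ ((suc i ≡ᵇ q) ∨ (i ≡ᵇ q))) ≡ degAt (λ i → f i ∧ (i <ᵇ k)) q
countBelow-adjacent k q f =
  trans (countBelow-∨ k f (λ i → suc i ≡ᵇ q) (λ i → i ≡ᵇ q) (λ i → suc-≡ᵇ-disjoint i q))
        (cong₂ _+_ (entering q) (countBelow-point k q f))
  where
  entering : ∀ q → countBelow k (λ i → f i ∧ (suc i ≡ᵇ q)) ≡ 𝟙 (incoming (λ i → f i ∧ (i <ᵇ k)) q)
  entering zero    = countBelow-false k (∧-zeroʳ ∘ f)
  entering (suc q) = countBelow-point k q f

degAt-shift : ∀ {c c' : ℕ → Bool} {i n l} → (∀ m → m < n → c' m ≡ c (i + m)) →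
  0 < l → l < n → degAt c' l ≡ degAt c (i + l)
degAt-shift {c} {c'} {i} {l = suc m} agree _ 1+m<n = begin
  𝟙 (c' m) + 𝟙 (c' (suc m))
    ≡⟨ cong₂ _+_ (cong 𝟙 (agree m (<-trans (n<1+n m) 1+m<n))) (cong 𝟙 (agree (suc m) 1+m<n)) ⟩
  𝟙 (c (i + m)) + 𝟙 (c (i + suc m)) ≡⟨ cong (λ n → 𝟙 (c (i + m)) + 𝟙 (c n)) (+-suc i m) ⟩
  degAt c (suc (i + m))             ≡⟨ cong (degAt c) (+-suc i m) ⟨
  degAt c (i + suc m)               ∎
  where open ≡-Reasoning

Σ< : ℕ → (ℕ → ℕ) → ℕ
Σ< zero    D = 0
Σ< (suc n) D = Σ< n D + D n

Σ<-degAt-even : ∀ (c : ℕ → Bool) m → Σ< (suc m) (λ j → degAt c (2 * j)) ≡ countBelow (suc (2 * m)) c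
Σ<-degAt-even c zero    = refl
Σ<-degAt-even c (suc m) = begin
  Σ< (suc m) D + degAt c (2 * suc m)                    ≡⟨ cong₂ _+_ (Σ<-degAt-even c m) (cong (degAt c) (*-suc 2 m)) ⟩
  countBelow r c + (𝟙 (c r) + 𝟙 (c (suc r)))            ≡⟨ +-assoc (countBelow r c) _ _ ⟨
  countBelow (suc (suc r)) c                            ≡⟨ cong (λ n → countBelow (suc n) c) (*-suc 2 m) ⟨
  countBelow (suc (2 * suc m)) c                        ∎
  where
  open ≡-Reasoning
  D : ℕ → ℕ
  D j = degAt c (2 * j)
  r : ℕ
  r = suc (2 * m)

Σ<-ones : ∀ n {D} → (∀ j → j < n → D j ≡ 1) → Σ< n D ≡ n
Σ<-ones zero    _    = refl
Σ<-ones (suc n) ones = trans (cong₂ _+_ (Σ<-ones n (λ j j<n → ones j (m<n⇒m<1+n j<n))) (ones n ≤-refl)) (+-comm n 1)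

Σ<-≤ : ∀ n {D} → (∀ j → j < n → D j ≤ 1) → Σ< n D ≤ n
Σ<-≤ zero    _   = z≤n
Σ<-≤ (suc n) D≤1 =
  ≤-trans (+-mono-≤ (Σ<-≤ n (λ j j<n → D≤1 j (m<n⇒m<1+n j<n))) (D≤1 n ≤-refl)) (≤-reflexive (+-comm n 1))

Σ<≡n⇒ones : ∀ n {D} → (∀ j → j < n → D j ≤ 1) → Σ< n D ≡ n → ∀ j → j < n → D j ≡ 1
Σ<≡n⇒ones (suc n) {D} D≤1 Σ≡ j j<1+n with ≤1-cases (D≤1 n ≤-refl)
... | inj₁ Dn≡0 = contradiction prefix≡ (<⇒≢ (s≤s (Σ<-≤ n (λ i i<n → D≤1 i (m<n⇒m<1+n i<n)))))
  where
  prefix≡ : Σ< n D ≡ suc n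
  prefix≡ = trans (sym (+-identityʳ _)) (trans (cong (Σ< n D +_) (sym Dn≡0)) Σ≡)
... | inj₂ Dn≡1 with m<1+n⇒m<n∨m≡n j<1+n
...   | inj₂ refl = Dn≡1
...   | inj₁ j<n  = Σ<≡n⇒ones n (λ i i<n → D≤1 i (m<n⇒m<1+n i<n)) prefix≡ j j<n
  where
  prefix≡ : Σ< n D ≡ n
  prefix≡ = +-cancelʳ-≡ 1 _ _ (trans (trans (cong (Σ< n D +_) (sym Dn≡1)) Σ≡) (+-comm 1 n))

Σ<-unique-zero : ∀ N {D} → (∀ j → j ≤ N → D j ≤ 1) → Σ< (suc N) D ≡ N →
  ∃ λ z → z ≤ N × D z ≡ 0 × (∀ j → j ≤ N → j ≢ z → D j ≡ 1)
Σ<-unique-zero zero    _   D0≡0 = 0 , z≤n , D0≡0 , λ { _ z≤n 0≢0 → contradiction refl 0≢0 }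
Σ<-unique-zero (suc N) {D} D≤1 Σ≡ with ≤1-cases (D≤1 (suc N) ≤-refl)
... | inj₁ Dlast≡0 = suc N , ≤-refl , Dlast≡0 , λ j j≤1+N j≢1+N → prefix-ones j (≤∧≢⇒< j≤1+N j≢1+N)
  where
  prefix≡ : Σ< (suc N) D ≡ suc N
  prefix≡ = trans (sym (+-identityʳ _)) (trans (cong (Σ< (suc N) D +_) (sym Dlast≡0)) Σ≡)
  prefix-ones : ∀ j → j < suc N → D j ≡ 1
  prefix-ones = Σ<≡n⇒ones (suc N) (λ i i<1+N → D≤1 i (<⇒≤ i<1+N)) prefix≡
... | inj₂ Dlast≡1 with Σ<-unique-zero N (λ j j≤N → D≤1 j (m≤n⇒m≤1+n j≤N)) prefix≡
  where
  prefix≡ : Σ< (suc N) D ≡ N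
  prefix≡ = +-cancelʳ-≡ 1 _ _ (trans (trans (cong (Σ< (suc N) D +_) (sym Dlast≡1)) Σ≡) (+-comm 1 N))
...   | z , z≤N , Dz≡0 , others = z , m≤n⇒m≤1+n z≤N , Dz≡0 , others′
  where
  others′ : ∀ j → j ≤ suc N → j ≢ z → D j ≡ 1
  others′ j j≤1+N j≢z with m≤n⇒m<n∨m≡n j≤1+N
  ... | inj₁ j<1+N = others j (≤-pred j<1+N) j≢z
  ... | inj₂ refl  = Dlast≡1

sign+2*𝟙≡1 : ∀ x → (if x then -1ℤ else 1ℤ) ℤ.+ ℤ.+ (2 * 𝟙 x) ≡ 1ℤ
sign+2*𝟙≡1 true  = refl
sign+2*𝟙≡1 false = refl

sumBelow-sign : ∀ k (b : ℕ → Bool) →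
  sumBelow k (λ i → if b i then -1ℤ else 1ℤ) ℤ.+ ℤ.+ (2 * countBelow k b) ≡ ℤ.+ k
sumBelow-sign zero    b = refl
sumBelow-sign (suc k) b = begin
  (S ℤ.+ s) ℤ.+ ℤ.+ (2 * (c + 𝟙 (b k)))
    ≡⟨ cong (λ x → (S ℤ.+ s) ℤ.+ x) (trans (cong ℤ.+_ (*-distribˡ-+ 2 c _)) (ℤ.pos-+ (2 * c) (2 * 𝟙 (b k)))) ⟩
  (S ℤ.+ s) ℤ.+ (ℤ.+ (2 * c) ℤ.+ ℤ.+ (2 * 𝟙 (b k)))   ≡⟨ ℤ-interchange S s _ _ ⟩
  (S ℤ.+ ℤ.+ (2 * c)) ℤ.+ (s ℤ.+ ℤ.+ (2 * 𝟙 (b k)))   ≡⟨ cong₂ ℤ._+_ (sumBelow-sign k b) (sign+2*𝟙≡1 (b k)) ⟩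
  ℤ.+ (k + 1)                                         ≡⟨ cong ℤ.+_ (+-comm k 1) ⟩
  ℤ.+ suc k                                           ∎
  where
  open ≡-Reasoning
  S s : ℤ
  S = sumBelow k (λ i → if b i then -1ℤ else 1ℤ)
  s = if b k then -1ℤ else 1ℤ
  c : ℕ
  c = countBelow k b

countFin≡sum : ∀ {k} (f : Fin k → Bool) → countFin f ≡ sum (𝟙 ∘ f)
countFin≡sum {zero}  f = refl
countFin≡sum {suc k} f = cong (𝟙 (f zero) +_) (countFin≡sum (f ∘ suc))

sum-mono-≤ : ∀ {k} {f g : Fin k → ℕ} → (∀ i → f i ≤ g i) → sum f ≤ sum g
sum-mono-≤ {zero}  _   = z≤n
sum-mono-≤ {suc k} f≤g = +-mono-≤ (f≤g zero) (sum-mono-≤ (f≤g ∘ suc))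

sum-δ : ∀ {k} (a : Fin k) → sum (λ i → 𝟙 ⌊ a Fin.≟ i ⌋) ≡ 1
sum-δ {suc k} a = begin
  sum δa                              ≡⟨ sum-remove {i = a} δa ⟩
  δa a + sum (δa ∘ punchIn a)         ≡⟨ cong₂ _+_ (cong 𝟙 (⌊⌋-true (a Fin.≟ a) refl)) (sum-cong-≗ {k} off-a) ⟩
  1 + sum {k} (λ _ → 0)              ≡⟨ cong (1 +_) (sum-replicate-zero k) ⟩
  1                                   ∎
  where
  open ≡-Reasoning
  δa : Fin (suc k) → ℕ
  δa i = 𝟙 ⌊ a Fin.≟ i ⌋
  off-a : ∀ j → δa (punchIn a j) ≡ 0
  off-a j = cong 𝟙 (⌊⌋-false (a Fin.≟ punchIn a j) (punchInᵢ≢i a j ∘ sym))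

countFin-≥2 : ∀ {k} (f : Fin k → Bool) {a b} → a ≢ b → f a ≡ true → f b ≡ true → 2 ≤ countFin f
countFin-≥2 f {a} {b} a≢b fa fb = begin
  2                                                   ≡⟨ cong₂ _+_ (sum-δ a) (sum-δ b) ⟨
  sum (λ i → 𝟙 ⌊ a Fin.≟ i ⌋) + sum (λ i → 𝟙 ⌊ b Fin.≟ i ⌋)
    ≡⟨ ∑-distrib-+ (λ i → 𝟙 ⌊ a Fin.≟ i ⌋) (λ i → 𝟙 ⌊ b Fin.≟ i ⌋) ⟨
  sum (λ i → 𝟙 ⌊ a Fin.≟ i ⌋ + 𝟙 ⌊ b Fin.≟ i ⌋)       ≤⟨ sum-mono-≤ indicators≤f ⟩
  sum (𝟙 ∘ f)                                         ≡⟨ countFin≡sum f ⟨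
  countFin f                                          ∎
  where
  open ≤-Reasoning
  indicators≤f : ∀ i → 𝟙 ⌊ a Fin.≟ i ⌋ + 𝟙 ⌊ b Fin.≟ i ⌋ ≤ 𝟙 (f i)
  indicators≤f i with a Fin.≟ i | b Fin.≟ i
  ... | yes refl | yes refl = contradiction refl a≢b
  ... | yes refl | no _     rewrite fa = ≤-refl
  ... | no _     | yes refl rewrite fb = ≤-refl
  ... | no _     | no _     = z≤n

odd⇒≥1 : ∀ {k} → k % 2 ≡ 1 → 1 ≤ k
odd⇒≥1 {zero}  ()
odd⇒≥1 {suc k} _ = s≤s z≤n

module _ (G : BipartiteGraft) where
  open BipartiteGraft G

  B-end-indicator : ∀ {w u} → inB w ≡ true → inB u ≡ false →
    ∀ v → inB v ∧ (⌊ w Fin.≟ v ⌋ ∨ ⌊ u Fin.≟ v ⌋) ≡ ⌊ w Fin.≟ v ⌋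
  B-end-indicator {w} {u} w∈B u∉B v with w Fin.≟ v | u Fin.≟ v
  ... | yes refl | _        = trans (∧-identityʳ (inB w)) w∈B
  ... | no _     | yes refl = trans (∧-identityʳ (inB u)) u∉B
  ... | no _     | no _     = ∧-zeroʳ (inB v)

  end₂-colour : ∀ e {b} → inB (end₁ e) ≡ b → inB (end₂ e) ≡ not b
  end₂-colour e end₁-colour = trans (¬-not (≢-sym (bipartite e))) (cong not end₁-colour)

  edge-has-one-B-end : ∀ e → sum (λ v → 𝟙 (inB v ∧ incident G e v)) ≡ 1
  edge-has-one-B-end e with inB (end₁ e) in end₁-colour
  ... | true  = trans (sum-cong-≗ {n} (cong 𝟙 ∘ B-end-indicator end₁-colour (end₂-colour e end₁-colour)))
                      (sum-δ (end₁ e))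
  ... | false = trans (sum-cong-≗ {n} λ v → cong 𝟙 (trans (cong (inB v ∧_) (∨-comm ⌊ end₁ e Fin.≟ v ⌋ _))
                                                 (B-end-indicator (end₂-colour e end₁-colour) end₁-colour v)))
                      (sum-δ (end₂ e))

  size≡sum-degIn-B : (F : EdgeSet G) →
    sum (λ v → countFin (λ e → inB v ∧ (F e ∧ incident G e v))) ≡ size G F
  size≡sum-degIn-B F = begin
    sum (λ v → countFin (λ e → atB v e))     ≡⟨ sum-cong-≗ {n} (λ v → countFin≡sum (atB v)) ⟩
    sum (λ v → sum (λ e → 𝟙 (atB v e)))      ≡⟨ ∑-comm (λ v e → 𝟙 (atB v e)) ⟩
    sum (λ e → sum (λ v → 𝟙 (atB v e)))      ≡⟨ sum-cong-≗ counted-once ⟩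
    sum (𝟙 ∘ F)                              ≡⟨ countFin≡sum F ⟨
    size G F                                 ∎
    where
    open ≡-Reasoning
    atB : Fin n → Fin m → Bool
    atB v e = inB v ∧ (F e ∧ incident G e v)
    counted-once : ∀ e → sum (λ v → 𝟙 (inB v ∧ (F e ∧ incident G e v))) ≡ 𝟙 (F e)
    counted-once e with F e
    ... | true  = edge-has-one-B-end e
    ... | false = trans (sum-cong-≗ (cong 𝟙 ∘ ∧-zeroʳ ∘ inB)) (sum-replicate-zero n)

  -- Every vertex of B ∩ T meets F, and b meets it twice.
  sizeBT<size : (F : EdgeSet G) → IsJoin G F → ∀ {b} → inB b ≡ true → 2 ≤ degIn G F b →
    sizeBT G < size G F
  sizeBT<size F F-join {b} b∈B 2≤deg = begin-strict
    sizeBT G                                              <⟨ n<1+n _ ⟩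
    suc (sizeBT G)                                        ≡⟨ +-comm 1 _ ⟩
    sizeBT G + 1                                          ≡⟨ cong₂ _+_ (countFin≡sum {n} _) (sym (sum-δ b)) ⟩
    sum (λ v → 𝟙 (inB v ∧ T v)) + sum (λ v → 𝟙 ⌊ b Fin.≟ v ⌋)
                                                          ≡⟨ ∑-distrib-+ (λ v → 𝟙 (inB v ∧ T v)) _ ⟨
    sum (λ v → 𝟙 (inB v ∧ T v) + 𝟙 ⌊ b Fin.≟ v ⌋)       ≤⟨ sum-mono-≤ pointwise ⟩
    sum (λ v → countFin (λ e → inB v ∧ (F e ∧ incident G e v))) ≡⟨ size≡sum-degIn-B F ⟩
    size G F                                              ∎
    where
    open ≤-Reasoning
    pointwise : ∀ v → 𝟙 (inB v ∧ T v) + 𝟙 ⌊ b Fin.≟ v ⌋ ≤ countFin (λ e → inB v ∧ (F e ∧ incident G e v))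
    pointwise v with inB v in v-colour | b Fin.≟ v
    ... | false | yes refl = contradiction (trans (sym b∈B) v-colour) λ ()
    ... | false | no _     = z≤n
    ... | true  | yes refl = ≤-trans (+-monoˡ-≤ 1 (𝟙≤1 (T b))) 2≤deg
    ... | true  | no _ with T v in v-in-T
    ...   | false = z≤n
    ...   | true  = odd⇒≥1 (proj₂ (F-join v) v-in-T)

  minJoin-degIn-B≤1 : IsQuasicomb G → ∀ {F} → IsMinJoin G F → ∀ {b} → inB b ≡ true → degIn G F b ≤ 1
  minJoin-degIn-B≤1 (J , J-join , |J|≡|B∩T| , _) {F} (F-join , F-min) {b} b∈B with degIn G F b ≤? 1
  ... | yes deg≤1 = deg≤1
  ... | no  deg≰1 =
    contradiction (subst (size G F ≤_) |J|≡|B∩T| (F-min J J-join)) (<⇒≱ (sizeBT<size F F-join b∈B (≰⇒> deg≰1)))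

  fEdges : EdgeSet G → PathData G → ℕ
  fEdges F Q = countBelow (len Q) (λ i → F (edg Q i))

  weight≡0⇒2*fEdges≡len : ∀ F Q → weight G F Q ≡ 0ℤ → 2 * fEdges F Q ≡ len Q
  weight≡0⇒2*fEdges≡len F Q w≡0 =
    ℤ.+-injective (trans (cong (ℤ._+ ℤ.+ (2 * fEdges F Q)) (sym w≡0)) (sumBelow-sign (len Q) (F ∘ edg Q)))

  2*fEdges≡len⇒weight≡0 : ∀ F Q → 2 * fEdges F Q ≡ len Q → weight G F Q ≡ 0ℤ
  2*fEdges≡len⇒weight≡0 F Q 2c≡len =
    ℤ-identityˡ-unique _ _
      (subst (λ n → weight G F Q ℤ.+ ℤ.+ n ≡ ℤ.+ len Q) 2c≡len (sumBelow-sign (len Q) (F ∘ edg Q)))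

  Balanced-intro : ∀ F Q →
    (∀ l → 0 < l → l < len Q → inB (vtx Q l) ≡ true → degPathIn G F Q (vtx Q l) ≡ 1) →
    Balanced G F Q
  Balanced-intro F Q interior-deg≡1 _ (l , l≤len , refl) v∈B v≢start v≢end =
    interior-deg≡1 l (n≢0⇒n>0 (v≢start ∘ cong (vtx Q))) (≤∧≢⇒< l≤len (v≢end ∘ cong (vtx Q))) v∈B

module Path (G : BipartiteGraft) (P : PathData G) (P-path : IsPath G P) where
  open BipartiteGraft G

  private
    L : ℕ
    L = len P
    v : ℕ → Fin n
    v = vtx P
    e : ℕ → Fin m
    e = edg P

  vtx-≟ : ∀ {i q} → i ≤ L → q ≤ L → ⌊ v i Fin.≟ v q ⌋ ≡ (i ≡ᵇ q)
  vtx-≟ {i} {q} i≤L q≤L with i ≟ q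
  ... | yes i≡q = trans (⌊⌋-true (v i Fin.≟ v q) (cong v i≡q)) (sym (≡ᵇ-true i≡q))
  ... | no  i≢q = trans (⌊⌋-false (v i Fin.≟ v q) (i≢q ∘ proj₂ P-path i q i≤L q≤L)) (sym (≡ᵇ-false i≢q))

  incident-vtx : ∀ {i q} → i < L → q ≤ L → incident G (e i) (v q) ≡ (suc i ≡ᵇ q) ∨ (i ≡ᵇ q)
  incident-vtx {i} {q} i<L q≤L with proj₁ P-path i i<L
  ... | inj₁ (end₁≡ , end₂≡) = trans (cong₂ _∨_ (at end₁≡ (<⇒≤ i<L)) (at end₂≡ i<L)) (∨-comm (i ≡ᵇ q) _)
    where
    at : ∀ {w a} → w ≡ v a → a ≤ L → ⌊ w Fin.≟ v q ⌋ ≡ (a ≡ᵇ q)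
    at refl a≤L = vtx-≟ a≤L q≤L
  ... | inj₂ (end₁≡ , end₂≡) = cong₂ _∨_ (at end₁≡ i<L) (at end₂≡ (<⇒≤ i<L))
    where
    at : ∀ {w a} → w ≡ v a → a ≤ L → ⌊ w Fin.≟ v q ⌋ ≡ (a ≡ᵇ q)
    at refl a≤L = vtx-≟ a≤L q≤L

  colour-step : ∀ {i} → i < L → inB (v (suc i)) ≡ not (inB (v i))
  colour-step {i} i<L = ¬-not (≢-sym colours-differ)
    where
    colours-differ : inB (v i) ≢ inB (v (suc i))
    colours-differ with proj₁ P-path i i<L
    ... | inj₁ (end₁≡ , end₂≡) = subst₂ (λ a b → inB a ≢ inB b) end₁≡ end₂≡ (bipartite (e i))
    ... | inj₂ (end₁≡ , end₂≡) = ≢-sym (subst₂ (λ a b → inB a ≢ inB b) end₁≡ end₂≡ (bipartite (e i)))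

  colour-even : ∀ j → 2 * j ≤ L → inB (v (2 * j)) ≡ inB (v 0)
  colour-even zero    _       = refl
  colour-even (suc j) 2j+2≤L = begin
    inB (v (2 * suc j))          ≡⟨ cong (inB ∘ v) (*-suc 2 j) ⟩
    inB (v (suc (suc (2 * j))))  ≡⟨ colour-step 2j+1<L ⟩
    not (inB (v (suc (2 * j))))  ≡⟨ cong not (colour-step (<-trans (n<1+n _) 2j+1<L)) ⟩
    not (not (inB (v (2 * j))))  ≡⟨ not-involutive _ ⟩
    inB (v (2 * j))              ≡⟨ colour-even j (<⇒≤ (<-trans (n<1+n _) 2j+1<L)) ⟩
    inB (v 0)                    ∎
    where
    open ≡-Reasoning
    2j+1<L : suc (2 * j) < L
    2j+1<L = subst (_≤ L) (*-suc 2 j) 2j+2≤L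

  B-position-even : inB (v 0) ≡ true → ∀ {q} → q ≤ L → inB (v q) ≡ true → ∃ λ j → q ≡ 2 * j
  B-position-even start∈B {q} q≤L q∈B with even-or-odd q
  ... | j , inj₁ q≡2j = j , q≡2j
  ... | j , inj₂ refl = contradiction (trans (sym q∈B) odd-colour) λ ()
    where
    odd-colour : inB (v (suc (2 * j))) ≡ false
    odd-colour = trans (colour-step q≤L) (cong not (trans (colour-even j (<⇒≤ q≤L)) start∈B))

  -- Labels of the edges of P, with the junk indices i ≥ len P switched off.
  labels : EdgeSet G → ℕ → Bool
  labels F i = F (e i) ∧ (i <ᵇ L)

  labels-< : ∀ F {i} → i < L → labels F i ≡ F (e i)
  labels-< F {i} i<L = trans (cong (F (e i) ∧_) (<ᵇ-true i<L)) (∧-identityʳ (F (e i)))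

  labels-len : ∀ F → labels F L ≡ false
  labels-len F = trans (cong (F (e L) ∧_) (<ᵇ-irrefl L)) (∧-zeroʳ (F (e L)))

  countBelow-labels : ∀ F → countBelow L (labels F) ≡ fEdges G F P
  countBelow-labels F = countBelow-cong L (λ i i<L → labels-< F i<L)

  degPathIn-vtx : ∀ F {q} → q ≤ L → degPathIn G F P (v q) ≡ degAt (labels F) q
  degPathIn-vtx F q≤L =
    trans (countBelow-cong L (λ i i<L → cong (F (e i) ∧_) (incident-vtx i<L q≤L)))
          (countBelow-adjacent L _ (F ∘ e))

  consecutive-edges-differ : ∀ {r} → suc r < L → e r ≢ e (suc r)
  consecutive-edges-differ {r} 1+r<L er≡er+1 = contradiction meets-v-r λ ()
    where
    open ≡-Reasoning
    r<L : r < L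
    r<L = <-trans (n<1+n r) 1+r<L
    meets-v-r : true ≡ false
    meets-v-r = begin
      true                               ≡⟨ ∨-zeroʳ (suc r ≡ᵇ r) ⟨
      (suc r ≡ᵇ r) ∨ true                ≡⟨ cong ((suc r ≡ᵇ r) ∨_) (≡ᵇ-true {r} refl) ⟨
      (suc r ≡ᵇ r) ∨ (r ≡ᵇ r)            ≡⟨ incident-vtx r<L (<⇒≤ r<L) ⟨
      incident G (e r) (v r)             ≡⟨ cong (λ f → incident G f (v r)) er≡er+1 ⟩
      incident G (e (suc r)) (v r)       ≡⟨ incident-vtx 1+r<L (<⇒≤ r<L) ⟩
      (suc (suc r) ≡ᵇ r) ∨ (suc r ≡ᵇ r)
        ≡⟨ cong₂ _∨_ (≡ᵇ-false (≢-sym (<⇒≢ (m<n⇒m<1+n (n<1+n r))))) (≡ᵇ-false (≢-sym (<⇒≢ (n<1+n r)))) ⟩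
      false                              ∎

  degAt-labels≤1 : ∀ F → (∀ {b} → inB b ≡ true → degIn G F b ≤ 1) →
    ∀ {q} → q ≤ L → inB (v q) ≡ true → degAt (labels F) q ≤ 1
  degAt-labels≤1 F degIn≤1 {zero}  _ _   = 𝟙≤1 (labels F 0)
  degAt-labels≤1 F degIn≤1 {suc r} _ q∈B = 𝟙+𝟙≤1 not-both
    where
    not-both : labels F r ≡ true → labels F (suc r) ≡ true → ⊥
    not-both r-in-F r+1-in-F = <⇒≱ (countFin-≥2 _ (consecutive-edges-differ 1+r<L) at-r at-r+1) (degIn≤1 q∈B)
      where
      1+r<L : suc r < L
      1+r<L = <ᵇ⇒< (suc r) L (Equivalence.from T-≡ (∧-conicalʳ _ _ r+1-in-F))
      at-r : F (e r) ∧ incident G (e r) (v (suc r)) ≡ true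
      at-r = cong₂ _∧_ (∧-conicalˡ _ _ r-in-F)
                       (trans (incident-vtx (<-trans (n<1+n r) 1+r<L) (<⇒≤ 1+r<L))
                              (cong (_∨ (r ≡ᵇ suc r)) (≡ᵇ-true {r} refl)))
      at-r+1 : F (e (suc r)) ∧ incident G (e (suc r)) (v (suc r)) ≡ true
      at-r+1 = cong₂ _∧_ (∧-conicalˡ _ _ r+1-in-F)
                         (trans (incident-vtx 1+r<L (<⇒≤ 1+r<L))
                                (trans (cong ((suc (suc r) ≡ᵇ suc r) ∨_) (≡ᵇ-true {r} refl)) (∨-zeroʳ _)))

  private
    end≤len : ∀ {i j} → i ≤ j → j ≤ L → i + (j ∸ i) ≤ L
    end≤len i≤j j≤L = ≤-trans (≤-reflexive (m+[n∸m]≡n i≤j)) j≤L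

  offset≤len : ∀ {i j l} → i ≤ j → j ≤ L → l ≤ j ∸ i → i + l ≤ L
  offset≤len {i} i≤j j≤L l≤j∸i = ≤-trans (+-monoʳ-≤ i l≤j∸i) (end≤len i≤j j≤L)

  offset<len : ∀ {i j l} → i ≤ j → j ≤ L → l < j ∸ i → i + l < L
  offset<len {i} i≤j j≤L l<j∸i = <-≤-trans (+-monoʳ-< i l<j∸i) (end≤len i≤j j≤L)

  subpath-isPath : ∀ {i j} → i ≤ j → j ≤ L → IsPath G (subpath G P i j)
  subpath-isPath {i} {j} i≤j j≤L = adjacent , injective
    where
    adjacent : ∀ l → l < j ∸ i →
        (end₁ (e (i + l)) ≡ v (i + l) × end₂ (e (i + l)) ≡ v (i + suc l))
      ⊎ (end₁ (e (i + l)) ≡ v (i + suc l) × end₂ (e (i + l)) ≡ v (i + l))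
    adjacent l l<j∸i = subst (λ w → (end₁ (e (i + l)) ≡ v (i + l) × end₂ (e (i + l)) ≡ v w)
                                    ⊎ (end₁ (e (i + l)) ≡ v w × end₂ (e (i + l)) ≡ v (i + l)))
                             (sym (+-suc i l)) (proj₁ P-path (i + l) (offset<len i≤j j≤L l<j∸i))
    injective : ∀ l l′ → l ≤ j ∸ i → l′ ≤ j ∸ i → v (i + l) ≡ v (i + l′) → l ≡ l′
    injective l l′ l≤ l′≤ eq =
      +-cancelˡ-≡ i l l′ (proj₂ P-path (i + l) (i + l′) (offset≤len i≤j j≤L l≤) (offset≤len i≤j j≤L l′≤) eq)

module _ (G : BipartiteGraft) (P : PathData G) (P-path : IsPath G P) where
  open Path G P P-path

  degPathIn-subpath : ∀ F {i j l} → (i≤j : i ≤ j) (j≤L : j ≤ len P) → 0 < l → l < j ∸ i →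
    degPathIn G F (subpath G P i j) (vtx P (i + l)) ≡ degPathIn G F P (vtx P (i + l))
  degPathIn-subpath F {i} {j} {l} i≤j j≤L 0<l l<j∸i = begin
    degPathIn G F Q (vtx Q l)   ≡⟨ Q.degPathIn-vtx F (<⇒≤ l<j∸i) ⟩
    degAt (Q.labels F) l        ≡⟨ degAt-shift {c = labels F} {i = i} agree 0<l l<j∸i ⟩
    degAt (labels F) (i + l)    ≡⟨ degPathIn-vtx F (offset≤len i≤j j≤L (<⇒≤ l<j∸i)) ⟨
    degPathIn G F P (vtx P (i + l)) ∎
    where
    open ≡-Reasoning
    Q : PathData G
    Q = subpath G P i j
    module Q = Path G Q (subpath-isPath i≤j j≤L)
    agree : ∀ m → m < j ∸ i → Q.labels F m ≡ labels F (i + m)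
    agree m m<j∸i = trans (Q.labels-< F m<j∸i) (sym (labels-< F (offset<len i≤j j≤L m<j∸i)))

module ZeroWeightPath
  (G : BipartiteGraft) (F : EdgeSet G)
  (degIn-B≤1 : ∀ {b} → BipartiteGraft.inB G b ≡ true → degIn G F b ≤ 1)
  (P : PathData G) (P-path : IsPath G P)
  (start∈B : BipartiteGraft.inB G (vtx P 0) ≡ true)
  (end∈B : BipartiteGraft.inB G (vtx P (len P)) ≡ true)
  (weight≡0 : weight G F P ≡ 0ℤ)
  where
  open BipartiteGraft G
  open Path G P P-path

  private
    L : ℕ
    L = len P
    v : ℕ → Fin n
    v = vtx P
    e : ℕ → Fin m
    e = edg P
    c : ℕ → Bool
    c = labels F

  half-length : ∃ λ K → L ≡ 2 * K
  half-length = B-position-even start∈B ≤-refl end∈B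

  K : ℕ
  K = proj₁ half-length

  L≡2K : L ≡ 2 * K
  L≡2K = proj₂ half-length

  fEdges≡K : fEdges G F P ≡ K
  fEdges≡K = *-cancelˡ-≡ _ _ 2 (trans (weight≡0⇒2*fEdges≡len G F P weight≡0) L≡2K)

  -- The vertices of B on P are v (2 * j) for j ≤ K; D j is the F-degree of v (2 * j) on P.
  D : ℕ → ℕ
  D j = degAt c (2 * j)

  2j≤L : ∀ {j} → j ≤ K → 2 * j ≤ L
  2j≤L j≤K = subst (_ ≤_) (sym L≡2K) (*-monoʳ-≤ 2 j≤K)

  D≤1 : ∀ j → j ≤ K → D j ≤ 1
  D≤1 j j≤K = degAt-labels≤1 F degIn-B≤1 (2j≤L j≤K) (trans (colour-even j (2j≤L j≤K)) start∈B)

  ΣD≡K : Σ< (suc K) D ≡ K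
  ΣD≡K = begin
    Σ< (suc K) D                          ≡⟨ Σ<-degAt-even c K ⟩
    countBelow (2 * K) c + 𝟙 (c (2 * K))  ≡⟨ cong (λ n → countBelow n c + 𝟙 (c n)) L≡2K ⟨
    countBelow L c + 𝟙 (c L)              ≡⟨ cong₂ _+_ (countBelow-labels F) (cong 𝟙 (labels-len F)) ⟩
    fEdges G F P + 0                      ≡⟨ +-identityʳ _ ⟩
    fEdges G F P                          ≡⟨ fEdges≡K ⟩
    K                                     ∎
    where open ≡-Reasoning

  private
    unique-zero : ∃ λ z → z ≤ K × D z ≡ 0 × (∀ j → j ≤ K → j ≢ z → D j ≡ 1)
    unique-zero = Σ<-unique-zero K D≤1 ΣD≡K

  j* : ℕ
  j* = proj₁ unique-zero

  j*≤K : j* ≤ K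
  j*≤K = proj₁ (proj₂ unique-zero)

  D≡1 : ∀ j → j ≤ K → j ≢ j* → D j ≡ 1
  D≡1 = proj₂ (proj₂ (proj₂ unique-zero))

  p : ℕ
  p = 2 * j*

  p≤L : p ≤ L
  p≤L = 2j≤L j*≤K

  p∈B : inB (v p) ≡ true
  p∈B = trans (colour-even j* p≤L) start∈B

  p-meets-no-F : incoming c p ≡ false × c p ≡ false
  p-meets-no-F = 𝟙-injective (m+n≡0⇒m≡0 _ D[j*]≡0) , 𝟙-injective (m+n≡0⇒n≡0 _ D[j*]≡0)
    where
    D[j*]≡0 : D j* ≡ 0
    D[j*]≡0 = proj₁ (proj₂ (proj₂ unique-zero))

  degPathIn-p≡0 : degPathIn G F P (v p) ≡ 0
  degPathIn-p≡0 = trans (degPathIn-vtx F p≤L) (proj₁ (proj₂ (proj₂ unique-zero)))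

  degPathIn-B≡1 : ∀ {q} → q ≤ L → inB (v q) ≡ true → q ≢ p → degPathIn G F P (v q) ≡ 1
  degPathIn-B≡1 {q} q≤L q∈B q≢p with B-position-even start∈B q≤L q∈B
  ... | j , refl = trans (degPathIn-vtx F q≤L)
                         (D≡1 j (*-cancelˡ-≤ 2 (subst (2 * j ≤_) L≡2K q≤L)) (q≢p ∘ cong (2 *_)))

  zero-degree-B-vertex-unique : ∀ z → OnPath G P z → inB z ≡ true → degPathIn G F P z ≡ 0 → z ≡ v p
  zero-degree-B-vertex-unique _ (q , q≤L , refl) q∈B deg≡0 with q ≟ p
  ... | yes q≡p = cong v q≡p
  ... | no  q≢p = contradiction (trans (sym deg≡0) (degPathIn-B≡1 q≤L q∈B q≢p)) λ ()

  subpath-ending-at-p-balanced : ∀ {i j} → i ≤ j → j ≤ L → p ≡ i ⊎ p ≡ j → Balanced G F (subpath G P i j)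
  subpath-ending-at-p-balanced {i} {j} i≤j j≤L p-is-end = Balanced-intro G F (subpath G P i j) interior-deg≡1
    where
    interior-deg≡1 : ∀ l → 0 < l → l < j ∸ i → inB (v (i + l)) ≡ true →
      degPathIn G F (subpath G P i j) (v (i + l)) ≡ 1
    interior-deg≡1 l 0<l l<j∸i w∈B =
      trans (degPathIn-subpath G P P-path F i≤j j≤L 0<l l<j∸i)
            (degPathIn-B≡1 (<⇒≤ (offset<len i≤j j≤L l<j∸i)) w∈B i+l≢p)
      where
      i+l≢p : i + l ≢ p
      i+l≢p i+l≡p =
        [ (λ p≡i → <-irrefl (sym (+-cancelˡ-≡ i l 0 (trans (trans i+l≡p p≡i) (sym (+-identityʳ i))))) 0<l)
        , (λ p≡j → <-irrefl (trans i+l≡p p≡j) (subst (i + l <_) (m+[n∸m]≡n i≤j) (+-monoʳ-< i l<j∸i)))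
        ]′ p-is-end

  prefix-fEdges≡j* : fEdges G F (subpath G P 0 p) ≡ j*
  prefix-fEdges≡j* = begin
    countBelow p (F ∘ e)      ≡⟨ countBelow-cong p (λ i i<p → sym (labels-< F (<-≤-trans i<p p≤L))) ⟩
    countBelow p c            ≡⟨ +-identityʳ _ ⟨
    countBelow p c + 0        ≡⟨ cong (λ b → countBelow p c + 𝟙 b) (proj₂ p-meets-no-F) ⟨
    countBelow (suc p) c      ≡⟨ Σ<-degAt-even c j* ⟨
    Σ< j* D + D j*            ≡⟨ cong (Σ< j* D +_) (proj₁ (proj₂ (proj₂ unique-zero))) ⟩
    Σ< j* D + 0               ≡⟨ +-identityʳ _ ⟩
    Σ< j* D                   ≡⟨ Σ<-ones j* (λ j j<j* → D≡1 j (≤-trans (<⇒≤ j<j*) j*≤K) (<⇒≢ j<j*)) ⟩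
    j*                        ∎
    where open ≡-Reasoning

  prefix-weight≡0 : weight G F (subpath G P 0 p) ≡ 0ℤ
  prefix-weight≡0 = 2*fEdges≡len⇒weight≡0 G F (subpath G P 0 p) (cong (2 *_) prefix-fEdges≡j*)

  suffix-weight≡0 : weight G F (subpath G P p L) ≡ 0ℤ
  suffix-weight≡0 = 2*fEdges≡len⇒weight≡0 G F (subpath G P p L) (begin
    2 * s              ≡⟨ m+n∸m≡n p (2 * s) ⟨
    p + 2 * s ∸ p      ≡⟨ cong (_∸ p) p+2s≡L ⟩
    L ∸ p              ∎)
    where
    open ≡-Reasoning
    s : ℕ
    s = fEdges G F (subpath G P p L)
    j*+s≡K : j* + s ≡ K
    j*+s≡K = begin
      j* + s                            ≡⟨ cong (_+ s) prefix-fEdges≡j* ⟨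
      countBelow p (F ∘ e) + s          ≡⟨ countBelow-+ p (L ∸ p) (F ∘ e) ⟨
      countBelow (p + (L ∸ p)) (F ∘ e)  ≡⟨ cong (λ n → countBelow n (F ∘ e)) (m+[n∸m]≡n p≤L) ⟩
      fEdges G F P                      ≡⟨ fEdges≡K ⟩
      K                                 ∎
    p+2s≡L : p + 2 * s ≡ L
    p+2s≡L = begin
      p + 2 * s     ≡⟨ *-distribˡ-+ 2 j* s ⟨
      2 * (j* + s)  ≡⟨ cong (2 *_) j*+s≡K ⟩
      2 * K         ≡⟨ L≡2K ⟨
      L             ∎

  balanced⇒p-is-end : Balanced G F P → v p ≡ v 0 ⊎ v p ≡ v L
  balanced⇒p-is-end P-balanced with p ≟ 0 | p ≟ L
  ... | yes p≡0 | _       = inj₁ (cong v p≡0)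
  ... | no _    | yes p≡L = inj₂ (cong v p≡L)
  ... | no p≢0  | no p≢L  = contradiction (trans (sym deg≡1) degPathIn-p≡0) λ ()
    where
    deg≡1 : degPathIn G F P (v p) ≡ 1
    deg≡1 = P-balanced (v p) (p , p≤L , refl) p∈B
              (p≢0 ∘ proj₂ P-path p 0 p≤L z≤n) (p≢L ∘ proj₂ P-path p L p≤L ≤-refl)

  unbalanced⇒end-pattern : ¬ Balanced G F P →
    0 < p × p < L × F (e 0) ≡ true × F (e (p ∸ 1)) ≡ false × F (e (L ∸ 1)) ≡ true × F (e p) ≡ false
  unbalanced⇒end-pattern P-unbalanced =
    0<p , p<L ,
    trans (sym (labels-< F 0<L)) (𝟙-injective {y = true} start-deg≡1) ,
    trans (sym (labels-< F p-1<L)) (trans (sym (incoming-pred p 0<p)) (proj₁ p-meets-no-F)) ,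
    trans (sym (labels-< F L-1<L)) (trans (sym (incoming-pred L 0<L)) (𝟙-injective {y = true} end-entered)) ,
    trans (sym (labels-< F p<L)) (proj₂ p-meets-no-F)
    where
    open ≡-Reasoning
    p≢0 : p ≢ 0
    p≢0 p≡0 = P-unbalanced (subpath-ending-at-p-balanced z≤n ≤-refl (inj₁ p≡0))
    p≢L : p ≢ L
    p≢L p≡L = P-unbalanced (subpath-ending-at-p-balanced z≤n ≤-refl (inj₂ p≡L))
    0<p : 0 < p
    0<p = n≢0⇒n>0 p≢0
    p<L : p < L
    p<L = ≤∧≢⇒< p≤L p≢L
    0<L : 0 < L
    0<L = <-≤-trans 0<p p≤L
    p-1<L : p ∸ 1 < L
    p-1<L = <-≤-trans (∸-monoʳ-< z<s 0<p) p≤L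
    L-1<L : L ∸ 1 < L
    L-1<L = ∸-monoʳ-< z<s 0<L
    start-deg≡1 : degAt c 0 ≡ 1
    start-deg≡1 = trans (sym (degPathIn-vtx F z≤n)) (degPathIn-B≡1 z≤n start∈B (p≢0 ∘ sym))
    end-entered : 𝟙 (incoming c L) ≡ 1
    end-entered = begin
      𝟙 (incoming c L)          ≡⟨ +-identityʳ _ ⟨
      𝟙 (incoming c L) + 0      ≡⟨ cong (λ b → 𝟙 (incoming c L) + 𝟙 b) (labels-len F) ⟨
      degAt c L                 ≡⟨ degPathIn-vtx F ≤-refl ⟨
      degPathIn G F P (v L)     ≡⟨ degPathIn-B≡1 ≤-refl end∈B (p≢L ∘ sym) ⟩
      1                         ∎

lemma7p8 : (G : BipartiteGraft) → IsQuasicomb G →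
    (F : EdgeSet G) → IsMinJoin G F →
    (x y : Fin (BipartiteGraft.n G)) →
    BipartiteGraft.inB G x ≡ true → BipartiteGraft.inB G y ≡ true →
    (P : PathData G) → IsPathBetween G P x y → weight G F P ≡ 0ℤ →
    Σ ℕ λ p → p ≤ len P
      × BipartiteGraft.inB G (vtx P p) ≡ true
      × degPathIn G F P (vtx P p) ≡ 0
      × (∀ z → OnPath G P z → BipartiteGraft.inB G z ≡ true →
           degPathIn G F P z ≡ 0 → z ≡ vtx P p)
      × Balanced G F (subpath G P 0 p) × weight G F (subpath G P 0 p) ≡ 0ℤ
      × Balanced G F (subpath G P p (len P)) × weight G F (subpath G P p (len P)) ≡ 0ℤ
      × (Balanced G F P → (vtx P p ≡ x) ⊎ (vtx P p ≡ y))
      × (¬ Balanced G F P →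
           (0 < p × p < len P
            × F (edg P 0) ≡ true × F (edg P (p ∸ 1)) ≡ false
            × F (edg P (len P ∸ 1)) ≡ true × F (edg P p) ≡ false))
lemma7p8 G quasicomb F F-minJoin _ _ x∈B y∈B P (P-path , refl , refl) weight≡0 =
  p , p≤L , p∈B , degPathIn-p≡0 , zero-degree-B-vertex-unique ,
  subpath-ending-at-p-balanced z≤n p≤L (inj₂ refl) , prefix-weight≡0 ,
  subpath-ending-at-p-balanced p≤L ≤-refl (inj₁ refl) , suffix-weight≡0 ,
  balanced⇒p-is-end , unbalanced⇒end-pattern
  where
  open ZeroWeightPath G F (minJoin-degIn-B≤1 G quasicomb F-minJoin) P P-path x∈B y∈B weight≡0
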